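{- Let $G$ be a $2$-connected graph and let $C$ be a longest cycle in $G$. Then no two consecutive vertices of $C$ form a separating set of $G$. -}

module Defs where

open import Data.Nat using (ℕ; zero; suc; _+_; _≤_; _<_)
open import Data.Nat.Properties using (_<?_)
open import Data.Fin using (Fin; toℕ; fromℕ<) renaming (zero to fzero)
open import Data.Unit using (⊤)
open import Data.Bool using (Bool; true; false)
open import Data.Product using (Σ; ∃; _×_; _,_)
open import Relation.Nullary using (¬_; yes; no)
open import Relation.Binary.PropositionalEquality using (_≡_; _≢_)
open import Function.Definitions using (Injective)

record Graph (n : ℕ) : Set where
  field
    adj   : Fin n → Fin n → Bool
    sym   : ∀ x y → adj x y ≡ adj y x
    loopless : ∀ x → adj x x ≡ false
open Graph public

Adj : ∀ {n} → Graph n → Fin n → Fin n → Set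
Adj G x y = adj G x y ≡ true

-- A walk from x to y using only vertices satisfying P
-- (i.e. a walk in the induced subgraph G[P]).
data WalkIn {n} (G : Graph n) (P : Fin n → Set) : Fin n → Fin n → Set where
  here : ∀ {x} → P x → WalkIn G P x x
  step : ∀ {x y z} → P x → Adj G x y → WalkIn G P y z → WalkIn G P x z

ConnectedIn : ∀ {n} → Graph n → (Fin n → Set) → Set
ConnectedIn G P = ∀ x y → P x → P y → WalkIn G P x y

Everything : ∀ {n} → Fin n → Set
Everything _ = ⊤

Connected : ∀ {n} → Graph n → Set
Connected G = ConnectedIn G Everything

-- G is 2-connected: more than 2 vertices and G - X is connected for every
-- set X of fewer than 2 vertices (i.e. G itself and each G - v).
TwoConnected : ∀ {n} → Graph n → Set
TwoConnected {n} G =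
  (2 < n) × Connected G × (∀ v → ConnectedIn G (λ x → x ≢ v))

SeparatingPair : ∀ {n} → Graph n → Fin n → Fin n → Set
SeparatingPair G u v =
  ¬ ConnectedIn G (λ x → (x ≢ u) × (x ≢ v))

next : ∀ {k} → Fin (suc k) → Fin (suc k)
next {k} i with suc (toℕ i) <? suc k
... | yes p = fromℕ< p
... | no _  = fzero

record Cycle {n} (G : Graph n) : Set where
  field
    len₋₁     : ℕ
    len≥3     : 3 ≤ suc len₋₁
    vertex    : Fin (suc len₋₁) → Fin n
    injective : Injective _≡_ _≡_ vertex
    adjacent  : ∀ i → Adj G (vertex i) (vertex (next i))
open Cycle public

length : ∀ {n} {G : Graph n} → Cycle G → ℕ
length C = suc (len₋₁ C)

Longest : ∀ {n} {G : Graph n} → Cycle G → Set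
Longest {G = G} C = ∀ (D : Cycle G) → length D ≤ length C

-- Let u = C i and v its successor.  The arc of C from v round to u, followed
-- by an ear from u to v through G - {u, v}, closes into a cycle longer than C.
-- Hence no vertex x of G - {u, v} can be cut off from the interior of the
-- arc: 2-connectivity gives walks from x avoiding {u, v} to a neighbour of u
-- and to a neighbour of v, and loop erasure of their concatenation is an ear
-- that the arc cannot meet.  Reachability is not decidable constructively, so
-- this is argued under double negation, which commutes with the finite
-- quantifier over vertices.
module Submission where

open import Defs renaming (sym to adj-sym)
open import Data.Nat using (ℕ; zero; suc; _+_; _∸_; _≤_; _<_; _%_; z≤n; s≤s; s≤s⁻¹; z<s; NonZero)
open import Data.Nat.Properties
open import Data.Nat.DivMod
  using (m<n⇒m%n≡m; m%n<n; %-distribˡ-+; m%n%n≡m%n; [m+n]%n≡m%n; m≤n⇒[n∸m]%m≡n%m; n%n≡0)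
open import Data.Fin using (Fin; toℕ) renaming (zero to fzero; suc to fsuc; _≟_ to _≟ᶠ_)
open import Data.Fin.Properties using (toℕ-injective; toℕ-fromℕ<; toℕ<n)
open import Data.Product using (Σ; ∃; _×_; _,_; proj₁; proj₂; swap)
open import Data.Sum using (_⊎_; inj₁; inj₂)
open import Data.Empty using (⊥-elim)
open import Data.Unit using (⊤; tt)
open import Relation.Nullary using (¬_; yes; no; contradiction)
open import Relation.Nullary.Negation using (¬¬-map)
open import Relation.Binary.Definitions using (tri<; tri≈; tri>)
open import Relation.Binary.PropositionalEquality
open import Function using (_∘_)

[m+n]%o≢m : ∀ {m n o} .{{_ : NonZero o}} → m < o → 0 < n → n < o → (m + n) % o ≢ m
[m+n]%o≢m {m} {n} {o} m<o 0<n n<o eq with m + n <? o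
... | yes m+n<o = <⇒≢ (m<m+n m 0<n) (sym (trans (sym (m<n⇒m%n≡m m+n<o)) eq))
... | no m+n≮o = <⇒≢ wrapped<m (trans (sym (m<n⇒m%n≡m (<-trans wrapped<m m<o)))
                                  (trans (m≤n⇒[n∸m]%m≡n%m o≤m+n) eq))
  where
  o≤m+n : o ≤ m + n
  o≤m+n = ≮⇒≥ m+n≮o
  wrapped<m : m + n ∸ o < m
  wrapped<m = +-cancelʳ-< o (m + n ∸ o) m
    (subst (_< m + o) (sym (m∸n+n≡m o≤m+n)) (+-monoʳ-< m n<o))

[x+a]%o≢[x+b]%o : ∀ x {a b o} .{{_ : NonZero o}} → a < b → b < o → (x + a) % o ≢ (x + b) % o
[x+a]%o≢[x+b]%o x {a} {b} {o} a<b b<o eq =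
  [m+n]%o≢m (m%n<n (x + a) o) (m<n⇒0<n∸m a<b) d<o (sym (trans eq shifted))
  where
  open ≡-Reasoning
  d<o : b ∸ a < o
  d<o = ≤-<-trans (m∸n≤m b a) b<o
  shifted : (x + b) % o ≡ ((x + a) % o + (b ∸ a)) % o
  shifted = begin
    (x + b) % o                       ≡⟨ cong (λ c → (x + c) % o) (m+[n∸m]≡n (<⇒≤ a<b)) ⟨
    (x + (a + (b ∸ a))) % o           ≡⟨ cong (_% o) (+-assoc x a (b ∸ a)) ⟨
    (x + a + (b ∸ a)) % o             ≡⟨ %-distribˡ-+ (x + a) (b ∸ a) o ⟩
    ((x + a) % o + (b ∸ a) % o) % o   ≡⟨ cong (λ c → ((x + a) % o + c) % o) (m<n⇒m%n≡m d<o) ⟩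
    ((x + a) % o + (b ∸ a)) % o       ∎

+-%-cancelˡ : ∀ x {a b o} .{{_ : NonZero o}} → a < o → b < o → (x + a) % o ≡ (x + b) % o → a ≡ b
+-%-cancelˡ x {a} {b} a<o b<o eq with <-cmp a b
... | tri< a<b _ _ = contradiction eq ([x+a]%o≢[x+b]%o x a<b b<o)
... | tri≈ _ a≡b _ = a≡b
... | tri> _ _ b<a = contradiction (sym eq) ([x+a]%o≢[x+b]%o x b<a a<o)

toℕ-next : ∀ {k} (j : Fin (suc k)) → toℕ (next j) ≡ suc (toℕ j) % suc k
toℕ-next {k} j with suc (toℕ j) <? suc k
... | yes j+1<k+1 = trans (toℕ-fromℕ< j+1<k+1) (sym (m<n⇒m%n≡m j+1<k+1))
... | no j+1≮k+1 = sym (trans (cong (_% suc k) j+1≡k+1) (n%n≡0 (suc k)))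
  where
  j+1≡k+1 : suc (toℕ j) ≡ suc k
  j+1≡k+1 = ≤-antisym (toℕ<n j) (≮⇒≥ j+1≮k+1)

rotate : ∀ {k} → Fin (suc k) → ℕ → Fin (suc k)
rotate j zero = j
rotate j (suc t) = next (rotate j t)

toℕ-rotate : ∀ {k} (j : Fin (suc k)) t → toℕ (rotate j t) ≡ (toℕ j + t) % suc k
toℕ-rotate {k} j zero = sym (trans (cong (_% suc k) (+-identityʳ (toℕ j))) (m<n⇒m%n≡m (toℕ<n j)))
toℕ-rotate {k} j (suc t) = begin
  toℕ (next (rotate j t))                     ≡⟨ toℕ-next (rotate j t) ⟩
  suc (toℕ (rotate j t)) % L                  ≡⟨ cong (λ c → suc c % L) (toℕ-rotate j t) ⟩
  (1 + (toℕ j + t) % L) % L                   ≡⟨ %-distribˡ-+ 1 ((toℕ j + t) % L) L ⟩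
  (1 % L + (toℕ j + t) % L % L) % L           ≡⟨ cong (λ c → (1 % L + c) % L) (m%n%n≡m%n (toℕ j + t) L) ⟩
  (1 % L + (toℕ j + t) % L) % L               ≡⟨ %-distribˡ-+ 1 (toℕ j + t) L ⟨
  suc (toℕ j + t) % L                         ≡⟨ cong (_% L) (+-suc (toℕ j) t) ⟨
  (toℕ j + suc t) % L                         ∎
  where
  open ≡-Reasoning
  L = suc k

rotate-period : ∀ {k} (j : Fin (suc k)) → rotate j (suc k) ≡ j
rotate-period {k} j = toℕ-injective (begin
  toℕ (rotate j (suc k))    ≡⟨ toℕ-rotate j (suc k) ⟩
  (toℕ j + suc k) % suc k   ≡⟨ [m+n]%n≡m%n (toℕ j) (suc k) ⟩
  toℕ j % suc k             ≡⟨ m<n⇒m%n≡m (toℕ<n j) ⟩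
  toℕ j                     ∎)
  where open ≡-Reasoning

rotate-next : ∀ {k} (j : Fin (suc k)) t → rotate (next j) t ≡ rotate j (suc t)
rotate-next j zero = refl
rotate-next j (suc t) = cong next (rotate-next j t)

rotate-injective : ∀ {k} (j : Fin (suc k)) {a b} → a < suc k → b < suc k → rotate j a ≡ rotate j b → a ≡ b
rotate-injective j {a} {b} a<k+1 b<k+1 eq = +-%-cancelˡ (toℕ j) a<k+1 b<k+1
  (trans (sym (toℕ-rotate j a)) (trans (cong toℕ eq) (toℕ-rotate j b)))

Adj-sym : ∀ {n} (G : Graph n) {x y} → Adj G x y → Adj G y x
Adj-sym G {x} {y} = trans (adj-sym G y x)

module _ {n} {G : Graph n} where

  mapʷ : ∀ {P P′ : Fin n → Set} {x y} → (∀ {z} → P z → P′ z) → WalkIn G P x y → WalkIn G P′ x y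
  mapʷ f (here p) = here (f p)
  mapʷ f (step p a w) = step (f p) a (mapʷ f w)

  module _ {P : Fin n → Set} where

    source-in : ∀ {x y} → WalkIn G P x y → P x
    source-in (here p) = p
    source-in (step p _ _) = p

    target-in : ∀ {x y} → WalkIn G P x y → P y
    target-in (here p) = p
    target-in (step _ _ w) = target-in w

    _++ʷ_ : ∀ {x y z} → WalkIn G P x y → WalkIn G P y z → WalkIn G P x z
    here _ ++ʷ w = w
    step p a v ++ʷ w = step p a (v ++ʷ w)

    reverseʷ : ∀ {x y} → WalkIn G P x y → WalkIn G P y x
    reverseʷ (here p) = here p
    reverseʷ (step p a w) = reverseʷ w ++ʷ step (source-in w) (Adj-sym G a) (here p)

    approach : ∀ {x} t → x ≢ t → WalkIn G P x t →
               ∃ λ a → WalkIn G (λ z → P z × z ≢ t) x a × Adj G a t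
    approach t x≢t (here _) = contradiction refl x≢t
    approach t x≢t (step {x} {y} p a w) with y ≟ᶠ t
    ... | yes refl = x , here (p , x≢t) , a
    ... | no y≢t with approach t y≢t w
    ... | b , v , b~t = b , step (p , x≢t) a v , b~t

    lengthʷ : ∀ {x y} → WalkIn G P x y → ℕ
    lengthʷ (here _) = 0
    lengthʷ (step _ _ w) = suc (lengthʷ w)

    visit : ∀ {x y} → WalkIn G P x y → ℕ → Fin n
    visit (here {x} _) _ = x
    visit (step {x} _ _ _) zero = x
    visit (step _ _ w) (suc t) = visit w t

    visit-source : ∀ {x y} (w : WalkIn G P x y) → visit w 0 ≡ x
    visit-source (here _) = refl
    visit-source (step _ _ _) = refl

    visit-target : ∀ {x y} (w : WalkIn G P x y) → visit w (lengthʷ w) ≡ y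
    visit-target (here _) = refl
    visit-target (step _ _ w) = visit-target w

    visit-adjacent : ∀ {x y} (w : WalkIn G P x y) {t} → t < lengthʷ w → Adj G (visit w t) (visit w (suc t))
    visit-adjacent (step _ a w) {zero} _ = subst (Adj G _) (sym (visit-source w)) a
    visit-adjacent (step _ _ w) {suc t} t<len = visit-adjacent w (s≤s⁻¹ t<len)

    walk-to-visit : ∀ {x y} (w : WalkIn G P x y) t → WalkIn G P x (visit w t)
    walk-to-visit (here p) _ = here p
    walk-to-visit (step p _ _) zero = here p
    walk-to-visit (step p a w) (suc t) = step p a (walk-to-visit w t)

    Simple : ∀ {x y} → WalkIn G P x y → Set
    Simple (here _) = ⊤
    Simple (step {x} _ _ w) = (∀ t → visit w t ≢ x) × Simple w

    visit-injective : ∀ {x y} (w : WalkIn G P x y) → Simple w →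
                      ∀ {a b} → a ≤ lengthʷ w → b ≤ lengthʷ w → visit w a ≡ visit w b → a ≡ b
    visit-injective (here _) _ {zero} {zero} _ _ _ = refl
    visit-injective (step _ _ _) _ {zero} {zero} _ _ _ = refl
    visit-injective (step _ _ _) (fresh , _) {zero} {suc b} _ _ eq = contradiction (sym eq) (fresh b)
    visit-injective (step _ _ _) (fresh , _) {suc a} {zero} _ _ eq = contradiction eq (fresh a)
    visit-injective (step _ _ w) (_ , simple) {suc a} {suc b} a≤len b≤len eq =
      cong suc (visit-injective w simple (s≤s⁻¹ a≤len) (s≤s⁻¹ b≤len) eq)

    suffix-from : ∀ x {y z} (w : WalkIn G P y z) → Simple w →
                  (∀ t → visit w t ≢ x) ⊎ Σ (WalkIn G P x z) Simple
    suffix-from x (here {y} p) _ with y ≟ᶠ x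
    ... | yes refl = inj₂ (here p , tt)
    ... | no y≢x = inj₁ (λ _ → y≢x)
    suffix-from x (step {y} p a w) simple with y ≟ᶠ x
    ... | yes refl = inj₂ (step p a w , simple)
    ... | no y≢x with suffix-from x w (proj₂ simple)
    ... | inj₂ suffix = inj₂ suffix
    ... | inj₁ x∉w = inj₁ λ { zero → y≢x ; (suc t) → x∉w t }

    loop-erase : ∀ {x y} → WalkIn G P x y → Σ (WalkIn G P x y) Simple
    loop-erase (here p) = here p , tt
    loop-erase (step {x} p a w) with loop-erase w
    ... | v , simple with suffix-from x v simple
    ... | inj₁ x∉v = step p a v , x∉v , simple
    ... | inj₂ suffix = suffix

-- Only at 0, …, at len belong to the path; at is unconstrained beyond len.
record Path {n} (G : Graph n) : Set where
  field
    len          : ℕ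
    at           : ℕ → Fin n
    at-injective : ∀ {a b} → a ≤ len → b ≤ len → at a ≡ at b → a ≡ b
    at-adjacent  : ∀ {t} → t < len → Adj G (at t) (at (suc t))
open Path

data Side (l : ℕ) : ℕ → Set where
  left  : ∀ {t} → t ≤ l → Side l t
  right : ∀ s → Side l (s + suc l)

side : ∀ l t → Side l t
side l t with t ≤? l
... | yes t≤l = left t≤l
... | no t≰l = subst (Side l) (m∸n+n≡m (≰⇒> t≰l)) (right (t ∸ suc l))

module Splice {A : Set} (l : ℕ) (f g : ℕ → A) where

  splice : ℕ → A
  splice t with t ≤? l
  ... | yes _ = f t
  ... | no _ = g (t ∸ suc l)

  splice-left : ∀ {t} → t ≤ l → splice t ≡ f t
  splice-left {t} t≤l with t ≤? l
  ... | yes _ = refl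
  ... | no t≰l = contradiction t≤l t≰l

  splice-right : ∀ s → splice (s + suc l) ≡ g s
  splice-right s with s + suc l ≤? l
  ... | yes s+l+1≤l = contradiction s+l+1≤l (<⇒≱ (m≤n+m (suc l) s))
  ... | no _ = cong g (m+n∸n≡m s (suc l))

module _ {n} {G : Graph n} where

  Disjoint : Path G → Path G → Set
  Disjoint p q = ∀ {a b} → a ≤ len p → b ≤ len q → at p a ≢ at q b

  join : (p q : Path G) → Adj G (at p (len p)) (at q 0) → Disjoint p q → Path G
  join p q edge disjoint = record
    { len = len q + suc (len p)
    ; at = Splice.splice (len p) (at p) (at q)
    ; at-injective = joined-injective
    ; at-adjacent = joined-adjacent
    }
    where
    l : ℕ
    l = len p
    open Splice l (at p) (at q) renaming (splice to vertex-at)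

    joined-injective : ∀ {a b} → a ≤ len q + suc l → b ≤ len q + suc l →
                       vertex-at a ≡ vertex-at b → a ≡ b
    joined-injective {a} {b} a≤ b≤ eq with side l a | side l b
    ... | left a≤l | left b≤l =
      at-injective p a≤l b≤l (trans (sym (splice-left a≤l)) (trans eq (splice-left b≤l)))
    ... | left a≤l | right s = contradiction
      (trans (sym (splice-left a≤l)) (trans eq (splice-right s)))
      (disjoint a≤l (+-cancelʳ-≤ (suc l) s (len q) b≤))
    ... | right s | left b≤l = contradiction
      (trans (sym (splice-left b≤l)) (trans (sym eq) (splice-right s)))
      (disjoint b≤l (+-cancelʳ-≤ (suc l) s (len q) a≤))
    ... | right s | right s′ = cong (_+ suc l) (at-injective q
      (+-cancelʳ-≤ (suc l) s (len q) a≤) (+-cancelʳ-≤ (suc l) s′ (len q) b≤)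
      (trans (sym (splice-right s)) (trans eq (splice-right s′))))

    joined-adjacent : ∀ {t} → t < len q + suc l → Adj G (vertex-at t) (vertex-at (suc t))
    joined-adjacent {t} t< with side l t
    ... | right s = subst₂ (Adj G) (sym (splice-right s)) (sym (splice-right (suc s)))
      (at-adjacent q (+-cancelʳ-< (suc l) s (len q) t<))
    ... | left t≤l with m≤n⇒m<n∨m≡n t≤l
    ... | inj₁ t<l = subst₂ (Adj G) (sym (splice-left (<⇒≤ t<l))) (sym (splice-left t<l))
      (at-adjacent p t<l)
    ... | inj₂ t≡l = subst (λ c → Adj G (vertex-at c) (vertex-at (suc c))) (sym t≡l)
      (subst₂ (Adj G) (sym (splice-left ≤-refl)) (sym (splice-right 0)) edge)

  join-first : ∀ p q edge (disjoint : Disjoint p q) → at (join p q edge disjoint) 0 ≡ at p 0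
  join-first p q _ _ = Splice.splice-left (len p) (at p) (at q) z≤n

  join-last : ∀ p q edge (disjoint : Disjoint p q) →
              at (join p q edge disjoint) (len (join p q edge disjoint)) ≡ at q (len q)
  join-last p q _ _ = Splice.splice-right (len p) (at p) (at q) (len q)

  close : (p : Path G) → 2 ≤ len p → Adj G (at p (len p)) (at p 0) → Cycle G
  close p 2≤len edge = record
    { len₋₁ = len p
    ; len≥3 = s≤s 2≤len
    ; vertex = λ j → at p (toℕ j)
    ; injective = λ {a} {b} → toℕ-injective ∘ at-injective p (s≤s⁻¹ (toℕ<n a)) (s≤s⁻¹ (toℕ<n b))
    ; adjacent = closed-adjacent
    }
    where
    closed-adjacent : ∀ j → Adj G (at p (toℕ j)) (at p (toℕ (next j)))
    closed-adjacent j with m≤n⇒m<n∨m≡n (s≤s⁻¹ (toℕ<n j))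
    ... | inj₁ j<len = subst (λ c → Adj G (at p (toℕ j)) (at p c))
      (sym (trans (toℕ-next j) (m<n⇒m%n≡m (s≤s j<len)))) (at-adjacent p j<len)
    ... | inj₂ j≡len = subst₂ (λ a c → Adj G (at p a) (at p c)) (sym j≡len)
      (sym (trans (toℕ-next j) (trans (cong (λ c → suc c % suc (len p)) j≡len) (n%n≡0 (suc (len p))))))
      edge

  simple-path : ∀ {P x y} (w : WalkIn G P x y) → Simple w → Path G
  simple-path w simple = record
    { len = lengthʷ w
    ; at = visit w
    ; at-injective = visit-injective w simple
    ; at-adjacent = visit-adjacent w
    }

  arc : (C : Cycle G) → Fin (length C) → Path G
  arc C i = record
    { len = len₋₁ C
    ; at = λ t → vertex C (rotate (next i) t)
    ; at-injective = λ a≤ b≤ eq → rotate-injective (next i) (s≤s a≤) (s≤s b≤) (injective C eq)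
    ; at-adjacent = λ {t} _ → adjacent C (rotate (next i) t)
    }

  arc-last : (C : Cycle G) (i : Fin (length C)) → at (arc C i) (len₋₁ C) ≡ vertex C i
  arc-last C i = cong (vertex C) (trans (rotate-next i (len₋₁ C)) (rotate-period i))

  at-interior-≢-first : (p : Path G) → ∀ {t} → 0 < t → t ≤ len p → at p t ≢ at p 0
  at-interior-≢-first p 0<t t≤len eq = <⇒≢ 0<t (sym (at-injective p t≤len z≤n eq))

  at-interior-≢-last : (p : Path G) → ∀ {t} → t < len p → at p t ≢ at p (len p)
  at-interior-≢-last p t<len eq = <⇒≢ t<len (at-injective p (<⇒≤ t<len) ≤-refl eq)

  interior-walk : (p : Path G) {P : Fin n → Set} → (∀ {t} → 0 < t → t < len p → P (at p t)) →
                  ∀ {t} → 0 < t → t < len p → WalkIn G P (at p t) (at p 1)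
  interior-walk p inP {suc zero} 0<t t<len = here (inP 0<t t<len)
  interior-walk p inP {suc (suc t)} 0<t t<len =
    step (inP 0<t t<len) (Adj-sym G (at-adjacent p t+1<len)) (interior-walk p inP z<s t+1<len)
    where
    t+1<len : suc t < len p
    t+1<len = <-trans (n<1+n (suc t)) t<len

¬¬-pull-Fin : ∀ {n} {A : Fin n → Set} → (∀ x → ¬ ¬ A x) → ¬ ¬ (∀ x → A x)
¬¬-pull-Fin {zero} _ ¬all = ¬all λ ()
¬¬-pull-Fin {suc n} {A} ¬¬A ¬all = ¬¬A fzero λ A0 →
  ¬¬-pull-Fin {n} {A ∘ fsuc} (¬¬A ∘ fsuc) λ Asuc → ¬all λ { fzero → A0 ; (fsuc x) → Asuc x }

module _ {n} {G : Graph n} where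

  ¬¬-connectedIn : ∀ {P} c → (∀ x → P x → ¬ ¬ WalkIn G P x c) → ¬ ¬ ConnectedIn G P
  ¬¬-connectedIn {P} c reach = ¬¬-map connect (¬¬-pull-Fin reach′)
    where
    reach′ : ∀ x → ¬ ¬ (P x → WalkIn G P x c)
    reach′ x ¬walk = ¬walk λ px → ⊥-elim (reach x px λ w → ¬walk λ _ → w)
    connect : (∀ x → P x → WalkIn G P x c) → ConnectedIn G P
    connect to-c x y px py = to-c x px ++ʷ reverseʷ (to-c y py)

  neighbour-reachable : TwoConnected G → ∀ {u v x} → u ≢ v → x ≢ u → x ≢ v →
                        ∃ λ a → WalkIn G (λ y → y ≢ u × y ≢ v) x a × Adj G a u
  neighbour-reachable (_ , _ , connected-without) {u} {v} {x} u≢v x≢u x≢v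
    with approach u x≢u (connected-without v x u x≢v u≢v)
  ... | a , w , a~u = a , mapʷ swap w , a~u

module LongestCycle {n} {G : Graph n} (2-connected : TwoConnected G)
                    (C : Cycle G) (longest : Longest C) (i : Fin (length C)) where

  private
    A : Path G
    A = arc C i
    m : ℕ
    m = len₋₁ C
    u v : Fin n
    u = vertex C i
    v = vertex C (next i)
    Avoiding : Fin n → Set
    Avoiding x = x ≢ u × x ≢ v

  u≢v : u ≢ v
  u≢v eq = <⇒≢ (≤-trans z<s (s≤s⁻¹ (len≥3 C)))
                (sym (at-injective A ≤-refl z≤n (trans (arc-last C i) eq)))

  arc-interior-avoiding : ∀ {t} → 0 < t → t < m → Avoiding (at A t)
  arc-interior-avoiding 0<t t<m =
    (λ eq → at-interior-≢-last A t<m (trans eq (sym (arc-last C i)))) ,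
    at-interior-≢-first A 0<t (<⇒≤ t<m)

  off-arc : ∀ {x y} → ¬ WalkIn G Avoiding x (at A 1) → WalkIn G Avoiding x y →
            ∀ {s} → s ≤ m → at A s ≢ y
  off-arc unreachable x⇝y {zero} _ eq = proj₂ (target-in x⇝y) (sym eq)
  off-arc unreachable x⇝y {suc s} s<m+1 eq with m≤n⇒m<n∨m≡n s<m+1
  ... | inj₁ s<m = unreachable (x⇝y ++ʷ subst (λ z → WalkIn G Avoiding z (at A 1)) eq
                     (interior-walk A arc-interior-avoiding z<s s<m))
  ... | inj₂ s≡m = proj₁ (target-in x⇝y) (trans (sym eq) (trans (cong (at A) s≡m) (arc-last C i)))

  no-ear : (E : Path G) → Adj G u (at E 0) → Adj G (at E (len E)) v → ¬ Disjoint A E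
  no-ear E u~E E~v disjoint =
    <⇒≱ (s≤s (m≤n+m (suc m) (len E))) (longest (close detour 2≤len closing))
    where
    A~E : Adj G (at A m) (at E 0)
    A~E = subst (λ z → Adj G z (at E 0)) (sym (arc-last C i)) u~E
    detour : Path G
    detour = join A E A~E disjoint
    2≤len : 2 ≤ len detour
    2≤len = ≤-trans (s≤s⁻¹ (len≥3 C)) (≤-trans (n≤1+n m) (m≤n+m (suc m) (len E)))
    closing : Adj G (at detour (len detour)) (at detour 0)
    closing = subst₂ (Adj G) (sym (join-last A E A~E disjoint)) (sym (join-first A E A~E disjoint))
      E~v

  reaches-arc : ∀ x → Avoiding x → ¬ ¬ WalkIn G Avoiding x (at A 1)
  reaches-arc x (x≢u , x≢v) unreachable
    with neighbour-reachable 2-connected u≢v x≢u x≢v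
       | neighbour-reachable 2-connected (u≢v ∘ sym) x≢v x≢u
  ... | a , x⇝a , a~u | b , x⇝b , b~v
    with loop-erase (reverseʷ x⇝a ++ʷ mapʷ swap x⇝b)
  ... | a⇝b , simple = no-ear (simple-path a⇝b simple)
    (subst (Adj G u) (sym (visit-source a⇝b)) (Adj-sym G a~u))
    (subst (λ z → Adj G z v) (sym (visit-target a⇝b)) b~v)
    (λ {_} {t} s≤m _ → off-arc unreachable (x⇝a ++ʷ walk-to-visit a⇝b t) s≤m)

lemma3p4 : ∀ {n} (G : Graph n) → TwoConnected G → (C : Cycle G) → Longest C →
    ∀ i → ¬ SeparatingPair G (vertex C i) (vertex C (next i))
lemma3p4 G 2-connected C longest i =
  ¬¬-connectedIn (at (arc C i) 1) (LongestCycle.reaches-arc 2-connected C longest i)
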